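{- Let $G=(V,E)$ be a graph on $n$ vertices such that there is a set $X\subseteq V$ with $|X|\le k$ and $G\setminus X$ an interval graph. Then the boolean-width of $G$ is at most $\log_2 n + k$.
   Context: For $A\subseteq V$ with complement $\bar A=V\setminus A$, let $\mathrm{bool\text{ - }dim}(A)=\log_2\left|\{N(S)\cap \bar A : S\subseteq A\}\right|$, where $N(S)$ is the set of vertices outside $S$ adjacent to some vertex of $S$. A decomposition tree of $G$ is a pair $(T,\delta)$ where $T$ is a tree whose internal nodes have degree 3 and $\delta$ is a bijection from the leaves of $T$ to $V$; each edge $e$ of $T$ splits the leaves into two parts, inducing a partition $(A_e,V\setminus A_e)$ of $V$. The boolean-width of $(T,\delta)$ is $\max_{e}\mathrm{bool\text{ - }dim}(A_e)$, and the boolean-width of $G$ is the minimum over all decomposition trees (for $|V|\le 1$ it is $0$). -}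

module Defs where

open import Data.Nat using (ℕ; zero; suc; _≤_; _*_; _^_)
open import Data.Bool using (Bool; true; false; not; _∧_; _∨_; T)
import Data.Bool.Properties as BoolP
open import Data.Fin using (Fin)
open import Data.Fin.Subset using (Subset; _∉_)
open import Data.Vec using (Vec; []; _∷_; lookup; tabulate)
import Data.Vec as Vec
open import Data.Vec.Properties using (≡-dec)
open import Data.List using (List; []; _∷_; _++_; map; length; filterᵇ; allFin; deduplicate)
open import Data.Bool.ListAction using (all; any)
open import Data.Product using (Σ; _×_; _,_)
open import Data.Sum using (_⊎_)
open import Function.Definitions using (Injective)
open import Function.Bundles using (_⇔_)
open import Relation.Binary.PropositionalEquality using (_≡_; _≢_)
open import Relation.Nullary using (¬_)

record Graph (n : ℕ) : Set where
  field
    adj    : Fin n → Fin n → Bool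
    sym    : ∀ u v → adj u v ≡ adj v u
    irrefl : ∀ v → adj v v ≡ false
open Graph public

allSubsets : (n : ℕ) → List (Subset n)
allSubsets zero    = [] ∷ []
allSubsets (suc n) = map (true ∷_) (allSubsets n) ++ map (false ∷_) (allSubsets n)

_⊆ᵇ_ : ∀ {n} → Subset n → Subset n → Bool
_⊆ᵇ_ {n} S A = all (λ i → not (lookup S i) ∨ lookup A i) (allFin n)

-- N(S) ∩ Ā : vertices v outside A adjacent to some vertex of S.
-- (Since S ⊆ A is assumed where used, v ∉ A already gives v ∉ S,
--  so this is exactly N(S) ∩ Ā with N(S) the open neighbourhood of S.)
nbrOut : ∀ {n} → Graph n → Subset n → Subset n → Subset n
nbrOut {n} G A S =
  tabulate (λ v → not (lookup A v) ∧ any (λ s → lookup S s ∧ adj G s v) (allFin n))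

-- |{ N(S) ∩ Ā : S ⊆ A }|, so that bool-dim(A) = log₂ (boolCount G A).
boolCount : ∀ {n} → Graph n → Subset n → ℕ
boolCount {n} G A =
  length (deduplicate (≡-dec BoolP._≟_)
           (map (nbrOut G A) (filterᵇ (λ S → S ⊆ᵇ A) (allSubsets n))))

data Walk {m : ℕ} (a : Fin m → Fin m → Bool) : Fin m → Fin m → Set where
  here : ∀ {x} → Walk a x x
  step : ∀ {x y z} → T (a x y) → Walk a y z → Walk a x z

data WalkAvoid {m : ℕ} (a : Fin m → Fin m → Bool) (p q : Fin m) : Fin m → Fin m → Set where
  here : ∀ {x} → WalkAvoid a p q x x
  step : ∀ {x y z} → T (a x y) → ¬ (x ≡ p × y ≡ q) → ¬ (x ≡ q × y ≡ p) →
         WalkAvoid a p q y z → WalkAvoid a p q x z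

degree : ∀ {m} → (Fin m → Fin m → Bool) → Fin m → ℕ
degree {m} a v = Vec.countᵇ (a v) (Vec.allFin m)

-- A tree: a simple graph that is connected and acyclic; acyclicity is
-- expressed as: every edge is a bridge (its removal disconnects its ends).
record Tree (m : ℕ) : Set where
  field
    tadj      : Fin m → Fin m → Bool
    tsym      : ∀ u v → tadj u v ≡ tadj v u
    tirrefl   : ∀ v → tadj v v ≡ false
    connected : ∀ x y → Walk tadj x y
    acyclic   : ∀ p q → T (tadj p q) → ¬ WalkAvoid tadj p q p q
open Tree public

-- We present δ through its
-- inverse `leaf : V → leaves`.
record DecompTree (n m : ℕ) : Set where
  field
    tree      : Tree m
    deg13     : ∀ t → degree (tadj tree) t ≡ 1 ⊎ degree (tadj tree) t ≡ 3
    leaf      : Fin n → Fin m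
    leaf-leaf : ∀ v → degree (tadj tree) (leaf v) ≡ 1
    leaf-inj  : Injective _≡_ _≡_ leaf
    leaf-onto : ∀ t → degree (tadj tree) t ≡ 1 → Σ (Fin n) (λ v → leaf v ≡ t)
open DecompTree public

IsCut : ∀ {n m} → DecompTree n m → Fin m → Fin m → Subset n → Set
IsCut D p q A =
  ∀ v → T (lookup A v) ⇔ WalkAvoid (tadj (tree D)) p q (leaf D v) p

-- "boolean-width of (T,δ) ≤ log₂ c", i.e. 2^{bool-dim(A_e)} ≤ c for every
-- edge e and both of its sides.
DecWidth≤log : ∀ {n m} → Graph n → DecompTree n m → ℕ → Set
DecWidth≤log G D c =
  ∀ p q → T (tadj (tree D) p q) → ∀ A → IsCut D p q A → boolCount G A ≤ c

-- "boolean-width of G ≤ log₂ c": for |V| ≤ 1 the boolean-width is 0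
-- (so the claim is 1 ≤ c); otherwise some decomposition tree has
-- boolean-width ≤ log₂ c (the minimum over a finite nonempty set).
BoolWidth≤log : ∀ {n} → Graph n → ℕ → Set
BoolWidth≤log {n} G c =
  (n ≤ 1 × 1 ≤ c) ⊎
  (2 ≤ n × Σ ℕ (λ m → Σ (DecompTree n m) (λ D → DecWidth≤log G D c)))

-- G \ X is an interval graph: the vertices outside X get closed intervals
-- [l v , r v] such that two distinct vertices outside X are adjacent iff
-- their intervals intersect.  (Endpoints in ℕ: for finitely many intervals
-- this loses no generality compared to real endpoints.)
IsIntervalAfterDeleting : ∀ {n} → Graph n → Subset n → Set
IsIntervalAfterDeleting {n} G X =
  Σ (Fin n → ℕ) λ l → Σ (Fin n → ℕ) λ r →
    (∀ v → v ∉ X → l v ≤ r v) ×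
    (∀ u v → u ∉ X → v ∉ X → u ≢ v →
       (T (adj G u v) ⇔ (l u ≤ r v × l v ≤ r u)))

-- Sort the vertices by left endpoint and hang them, in this order, from a caterpillar. Every
-- edge of the caterpillar then cuts off a single vertex, all but one vertex, a prefix or a
-- suffix of the order. For each such side A, the neighbourhoods in Ā ∖ X of the vertices of
-- A ∖ X are nested: by right endpoints for a prefix, by left endpoints for a suffix. Hence for
-- S ⊆ A the set N(S) ∩ Ā is determined by X ∩ (S ∪ N(S)) together with a vertex of S ∖ X with
-- the largest neighbourhood, so there are at most 2^|X| · n such sets.

module Submission where

open import Defs hiding (sym; leaf)

open import Data.Bool using (Bool; true; false; not; _∧_; _∨_; T; T?)
open import Data.Bool.Properties using (T-∧; T-∨; T-≡; ∨-comm) renaming (_≟_ to _≟ᵇ_)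
open import Data.Bool.ListAction using (any)
open import Data.Fin using (Fin; toℕ; fromℕ<; punchOut) renaming (zero to fzero; suc to fsuc)
import Data.Fin as Fin
open import Data.Fin.Properties
  using (any?; toℕ<n; toℕ-injective; toℕ-fromℕ<; fromℕ<-toℕ; splitAt-join; join-splitAt; injective⇒≤;
         punchOut-injective)
open import Data.Fin.Subset using (Subset; ∣_∣; _∩_; _∪_; ∁; ⁅_⁆; _∈_; _∉_; _⊆_; inside; outside)
open import Data.Fin.Subset.Properties
  using (_∈?_; drop-∷-⊆; x∈p∩q⁺; x∈p∩q⁻; x∈p∪q⁺; x∈p∪q⁻; x∈⁅y⁆⇔x≡y; x∉p⇒x∈∁p; x∈∁p⇒x∉p; ⊆-antisym;
         p⊂q⇒∣p∣<∣q∣; ∣⊤∣≡n; ∈⊤)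
open import Data.List using (List; []; _∷_; _++_; map; length; filterᵇ; allFin; cartesianProductWith)
import Data.List as List
open import Data.List.Membership.Propositional using (lose) renaming (_∈_ to _∈ₗ_)
open import Data.List.Membership.Propositional.Properties
  using (∈-map⁺; ∈-map⁻; ∈-filter⁺; ∈-filter⁻; ∈-allFin; ∈-++⁺ˡ; ∈-++⁺ʳ)
open import Data.List.Properties using (length-++; length-map; length-removeAt′; length-tabulate)
open import Data.List.Relation.Unary.All as All using ([]; _∷_)
open import Data.List.Relation.Unary.All.Properties using (all⁺)
open import Data.List.Relation.Unary.AllPairs using ([]; _∷_)
open import Data.List.Relation.Unary.Any using (here; there; _─_; index; satisfied)
open import Data.List.Relation.Unary.Any.Properties
  using (any⁺; any⁻; cartesianProductWith⁺; deduplicate⁻)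
open import Data.List.Relation.Unary.Unique.Propositional using (Unique)
import Data.List.Relation.Unary.Unique.Propositional.Properties as Unique
open import Data.List.Relation.Unary.Unique.DecPropositional.Properties using (deduplicate-!)
open import Data.Nat
  using (ℕ; zero; suc; _+_; _*_; _^_; _∸_; _⊓_; _≤_; _<_; _≤′_; ≤′-reflexive; ≤′-step; z≤n; s≤s;
         _≟_; _≤?_; _<?_; _<ᵇ_)
open import Data.Nat.Properties
  using (≤-refl; ≤-trans; ≤-antisym; ≤-total; ≤-pred; <-trans; <-irrefl; <-asym; <-cmp; <⇒≤; <⇒≢; ≤∧≢⇒<;
         ≰⇒>; ≮⇒≥; 1+n≰n; n<1+n; n≤1+n; m<n⇒m<1+n; ≤⇒≤′; ≤′⇒≤; <ᵇ⇒<; <⇒<ᵇ; +-comm; +-identityʳ; *-comm;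
         *-identityˡ; +-cancelˡ-≡; +-monoʳ-<; *-monoˡ-≤; m≤m+n; ^-monoʳ-≤; m^n>0; m⊓n≤n; ⊓-monoˡ-≤; ∸-monoˡ-≤;
         m≤n⇒m⊓n≡m; m≥n⇒m⊓n≡n; module ≤-Reasoning)
open import Data.Product using (∃; _×_; _,_; proj₁; proj₂; swap)
import Data.Product as Prod
open import Data.Sum using (_⊎_; inj₁; inj₂; [_,_])
import Data.Sum as Sum
open import Data.Vec using ([]; _∷_; lookup; tabulate)
import Data.Vec as Vec
open import Data.Vec.Properties using (≡-dec; lookup∘tabulate; []=⇒lookup; lookup⇒[]=)
open import Function.Base using (_∘_; id)
open import Function.Bundles using (Equivalence; _⇔_; mk⇔)
open import Function.Definitions using (Injective)
open import Relation.Binary.Definitions using (tri<; tri≈; tri>)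
open import Relation.Binary.PropositionalEquality
  using (_≡_; _≢_; refl; sym; trans; cong; cong₂; subst; subst₂; module ≡-Reasoning)
open import Relation.Nullary using (¬_; Dec; yes; no; contradiction; ¬?; _×-dec_; ⌊_⌋; recompute)
open import Relation.Nullary.Decidable using (toWitness; fromWitness; decidable-stable)
open import Relation.Unary using (Decidable)

open Equivalence using (to; from)

T-not : ∀ {b} → T (not b) ⇔ (¬ T b)
T-not {false} = mk⇔ (λ _ ()) (λ _ → _)
T-not {true}  = mk⇔ (λ ()) (λ ¬t → ¬t _)

T-any-allFin : ∀ {n} (p : Fin n → Bool) → T (any p (allFin n)) ⇔ ∃ λ u → T (p u)
T-any-allFin {n} p = mk⇔ (satisfied ∘ any⁻ p (allFin n)) (λ (u , pu) → any⁺ p (lose (∈-allFin u) pu))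

module _ {A : Set} where

  ∈-─ : ∀ {x y : A} {xs} (x∈xs : x ∈ₗ xs) → y ∈ₗ xs → y ≢ x → y ∈ₗ (xs ─ x∈xs)
  ∈-─ (here refl)  (here refl) y≢x = contradiction refl y≢x
  ∈-─ (here _)     (there y∈)  _   = y∈
  ∈-─ (there _)    (here refl) _   = here refl
  ∈-─ (there x∈xs) (there y∈)  y≢x = there (∈-─ x∈xs y∈ y≢x)

  Unique⇒length≤ : ∀ {xs ys : List A} → Unique xs → (∀ {z} → z ∈ₗ xs → z ∈ₗ ys) → length xs ≤ length ys
  Unique⇒length≤ {[]}     _             _     = z≤n
  Unique⇒length≤ {x ∷ xs} {ys} (x∉xs ∷ xs!) xs⊆ys =
    subst (suc (length xs) ≤_) (sym (length-removeAt′ ys (index x∈ys)))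
      (s≤s (Unique⇒length≤ xs! λ y∈xs →
        ∈-─ x∈ys (xs⊆ys (there y∈xs)) (λ y≡x → All.lookup x∉xs y∈xs (sym y≡x))))
    where
      x∈ys : x ∈ₗ ys
      x∈ys = xs⊆ys (here refl)

  length-cartesianProductWith : ∀ {B C : Set} (f : A → B → C) xs ys →
    length (cartesianProductWith f xs ys) ≡ length xs * length ys
  length-cartesianProductWith f []       ys = refl
  length-cartesianProductWith f (x ∷ xs) ys = begin
    length (map (f x) ys ++ cartesianProductWith f xs ys) ≡⟨ length-++ (map (f x) ys) ⟩
    length (map (f x) ys) + length (cartesianProductWith f xs ys)
      ≡⟨ cong₂ _+_ (length-map (f x) ys) (length-cartesianProductWith f xs ys) ⟩
    length ys + length xs * length ys ∎
    where open ≡-Reasoning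

  module _ {P : A → Set} (P? : Decidable P) {_≼_ : A → A → Set}
           (≼-refl : ∀ {x} → x ≼ x) (≼-trans : ∀ {x y z} → x ≼ y → y ≼ z → x ≼ z)
           (≼-total : ∀ {x y} → P x → P y → x ≼ y ⊎ y ≼ x) where

    maximum-or-none : ∀ xs → (∃ λ m → P m × ∀ {y} → y ∈ₗ xs → P y → y ≼ m) ⊎ (∀ {y} → y ∈ₗ xs → ¬ P y)
    maximum-or-none []       = inj₂ λ ()
    maximum-or-none (x ∷ xs) with P? x | maximum-or-none xs
    ... | no ¬Px | inj₁ (m , Pm , max) =
          inj₁ (m , Pm , λ { (here refl) Py → contradiction Py ¬Px ; (there y∈) → max y∈ })
    ... | no ¬Px | inj₂ none = inj₂ λ { (here refl) → ¬Px ; (there y∈) → none y∈ }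
    ... | yes Px | inj₂ none =
          inj₁ (x , Px , λ { (here refl) _ → ≼-refl ; (there y∈) Py → contradiction Py (none y∈) })
    ... | yes Px | inj₁ (m , Pm , max) with ≼-total Px Pm
    ...   | inj₁ x≼m = inj₁ (m , Pm , λ { (here refl) _ → x≼m ; (there y∈) → max y∈ })
    ...   | inj₂ m≼x = inj₁ (x , Px , λ { (here refl) _ → ≼-refl ; (there y∈) Py → ≼-trans (max y∈ Py) m≼x })

∈⇔T-lookup : ∀ {n} {p : Subset n} {v} → v ∈ p ⇔ T (lookup p v)
∈⇔T-lookup {p = p} {v} = mk⇔ (from T-≡ ∘ []=⇒lookup) (lookup⇒[]= v p ∘ to T-≡)

subsetsOf : ∀ {n} → Subset n → List (Subset n)
subsetsOf []          = [] ∷ []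
subsetsOf (true ∷ X)  = map (true ∷_) (subsetsOf X) ++ map (false ∷_) (subsetsOf X)
subsetsOf (false ∷ X) = map (false ∷_) (subsetsOf X)

length-subsetsOf : ∀ {n} (X : Subset n) → length (subsetsOf X) ≡ 2 ^ ∣ X ∣
length-subsetsOf []          = refl
length-subsetsOf (true ∷ X)  = begin
  length (map (true ∷_) (subsetsOf X) ++ map (false ∷_) (subsetsOf X))
    ≡⟨ length-++ (map (true ∷_) (subsetsOf X)) ⟩
  length (map (true ∷_) (subsetsOf X)) + length (map (false ∷_) (subsetsOf X))
    ≡⟨ cong₂ _+_ (length-map (true ∷_) (subsetsOf X)) (length-map (false ∷_) (subsetsOf X)) ⟩
  length (subsetsOf X) + length (subsetsOf X)
    ≡⟨ cong (λ k → k + k) (length-subsetsOf X) ⟩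
  2 ^ ∣ X ∣ + 2 ^ ∣ X ∣
    ≡⟨ cong (2 ^ ∣ X ∣ +_) (sym (+-identityʳ (2 ^ ∣ X ∣))) ⟩
  2 ^ ∣ X ∣ + (2 ^ ∣ X ∣ + 0) ∎
  where open ≡-Reasoning
length-subsetsOf (false ∷ X) = trans (length-map (false ∷_) (subsetsOf X)) (length-subsetsOf X)

∈-subsetsOf : ∀ {n} {W X : Subset n} → W ⊆ X → W ∈ₗ subsetsOf X
∈-subsetsOf {W = []}        {[]}        _   = here refl
∈-subsetsOf {W = true ∷ W}  {true ∷ X}  W⊆X = ∈-++⁺ˡ (∈-map⁺ (true ∷_) (∈-subsetsOf (drop-∷-⊆ W⊆X)))
∈-subsetsOf {W = false ∷ W} {true ∷ X}  W⊆X =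
  ∈-++⁺ʳ (map (true ∷_) (subsetsOf X)) (∈-map⁺ (false ∷_) (∈-subsetsOf (drop-∷-⊆ W⊆X)))
∈-subsetsOf {W = true ∷ W}  {false ∷ X} W⊆X = contradiction (W⊆X Vec.here) λ ()
∈-subsetsOf {W = false ∷ W} {false ∷ X} W⊆X = ∈-map⁺ (false ∷_) (∈-subsetsOf (drop-∷-⊆ W⊆X))

⊆ᵇ⇒⊆ : ∀ {n} {S A : Subset n} → T (S ⊆ᵇ A) → S ⊆ A
⊆ᵇ⇒⊆ {n} {S} {A} S⊆ᵇA {u} u∈S =
  from ∈⇔T-lookup ([ (λ ¬Su → contradiction (to ∈⇔T-lookup u∈S) (to T-not ¬Su)) , id ]
    (to T-∨ (All.lookup (all⁺ (λ i → not (lookup S i) ∨ lookup A i) (allFin n) S⊆ᵇA) (∈-allFin u))))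

module _ {n} (G : Graph n) (A S : Subset n) {v : Fin n} where

  nbrOut⁻ : v ∈ nbrOut G A S → v ∉ A × ∃ λ u → u ∈ S × T (adj G u v)
  nbrOut⁻ v∈N
    with ¬Av , S~v ← to T-∧ (subst T (lookup∘tabulate _ v) (to ∈⇔T-lookup v∈N))
    with u , Su~v ← to (T-any-allFin (λ u → lookup S u ∧ adj G u v)) S~v
    with Su , u~v ← to T-∧ Su~v
    = to T-not ¬Av ∘ to ∈⇔T-lookup , u , from ∈⇔T-lookup Su , u~v

  nbrOut⁺ : v ∉ A → ∀ {u} → u ∈ S → T (adj G u v) → v ∈ nbrOut G A S
  nbrOut⁺ v∉A {u} u∈S u~v = from ∈⇔T-lookup (subst T (sym (lookup∘tabulate _ v))
    (from T-∧ (from T-not (v∉A ∘ from ∈⇔T-lookup) ,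
               from (T-any-allFin (λ u → lookup S u ∧ adj G u v)) (u , from T-∧ (to ∈⇔T-lookup u∈S , u~v)))))

-- Neighbourhood traces

module Traces {n} (G : Graph n) (A X : Subset n) where

  _≼_ : Fin n → Fin n → Set
  a ≼ a' = ∀ v → v ∉ A → v ∉ X → T (adj G a v) → T (adj G a' v)

  ≼-refl : ∀ {a} → a ≼ a
  ≼-refl _ _ _ a~v = a~v

  ≼-trans : ∀ {a b c} → a ≼ b → b ≼ c → a ≼ c
  ≼-trans a≼b b≼c v v∉A v∉X = b≼c v v∉A v∉X ∘ a≼b v v∉A v∉X

  Nested : Set
  Nested = ∀ {a a'} → a ∈ A → a ∉ X → a' ∈ A → a' ∉ X → a ≼ a' ⊎ a' ≼ a

  footprint : Subset n → Subset n
  footprint S = X ∩ (S ∪ nbrOut G A S)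

  trace : Subset n → Fin n → Subset n
  trace W s = (W ∩ ∁ A) ∪ (nbrOut G A ((W ∪ ⁅ s ⁆) ∩ A) ∩ ∁ X)

  record Representative (S : Subset n) (s : Fin n) : Set where
    field
      dominates : ∀ {u} → u ∈ S → u ∉ X → s ∈ A × u ≼ s
      sound     : s ∈ A → ∀ {v} → v ∉ A → T (adj G s v) → ∃ λ u → u ∈ S × T (adj G u v)

  module _ {S : Subset n} (S⊆A : S ⊆ A) where

    -- If S ∖ X is empty, any vertex outside A represents S, and if there is none, any vertex at all.
    representative : Nested → Fin n → ∃ (Representative S)
    representative nested z
      with maximum-or-none (λ u → (u ∈? S) ×-dec ¬? (u ∈? X)) ≼-refl ≼-trans
             (λ (a∈S , a∉X) (b∈S , b∉X) → nested (S⊆A a∈S) a∉X (S⊆A b∈S) b∉X) (allFin n)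
    ... | inj₁ (m , (m∈S , _) , max) =
          m , record { dominates = λ u∈S u∉X → S⊆A m∈S , max (∈-allFin _) (u∈S , u∉X)
                     ; sound     = λ _ _ m~v → m , m∈S , m~v }
    ... | inj₂ none with any? (λ v → ¬? (v ∈? A))
    ...   | yes (v , v∉A) =
            v , record { dominates = λ u∈S u∉X → contradiction (u∈S , u∉X) (none (∈-allFin _))
                       ; sound     = λ v∈A → contradiction v∈A v∉A }
    ...   | no ∄v∉A =
            z , record { dominates = λ u∈S u∉X → contradiction (u∈S , u∉X) (none (∈-allFin _))
                       ; sound     = λ _ {v} v∉A → contradiction (v , v∉A) ∄v∉A }

    nbrOut≡trace : ∀ {s} → Representative S s → nbrOut G A S ≡ trace (footprint S) s
    nbrOut≡trace {s} rep = ⊆-antisym ⊆trace trace⊆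
      where
        open Representative rep
        W S′ : Subset n
        W  = footprint S
        S′ = (W ∪ ⁅ s ⁆) ∩ A

        W⁻ : ∀ {u} → u ∈ W → u ∈ X × (u ∈ S ⊎ u ∈ nbrOut G A S)
        W⁻ {u} u∈W = Prod.map₂ (x∈p∪q⁻ S (nbrOut G A S)) (x∈p∩q⁻ X (S ∪ nbrOut G A S) u∈W)

        inS′ : ∀ {u} → u ∈ W ⊎ u ≡ s → u ∈ A → u ∈ S′
        inS′ u∈W⊎u≡s u∈A = x∈p∩q⁺ (x∈p∪q⁺ (Sum.map₂ (from x∈⁅y⁆⇔x≡y) u∈W⊎u≡s) , u∈A)

        via-S′ : ∀ {v u} → v ∉ A → v ∉ X → u ∈ S′ → T (adj G u v) → v ∈ trace W s
        via-S′ v∉A v∉X u∈S′ u~v = x∈p∪q⁺ (inj₂ (x∈p∩q⁺ (nbrOut⁺ G A S′ v∉A u∈S′ u~v , x∉p⇒x∈∁p v∉X)))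

        ⊆trace : nbrOut G A S ⊆ trace W s
        ⊆trace {v} v∈N with nbrOut⁻ G A S v∈N
        ... | v∉A , u , u∈S , u~v with v ∈? X | u ∈? X
        ...   | yes v∈X | _ = x∈p∪q⁺ (inj₁ (x∈p∩q⁺ (x∈p∩q⁺ (v∈X , x∈p∪q⁺ (inj₂ v∈N)) , x∉p⇒x∈∁p v∉A)))
        ...   | no v∉X | yes u∈X =
                  via-S′ v∉A v∉X (inS′ (inj₁ (x∈p∩q⁺ (u∈X , x∈p∪q⁺ (inj₁ u∈S)))) (S⊆A u∈S)) u~v
        ...   | no v∉X | no u∉X with s∈A , u≼s ← dominates u∈S u∉X =
                  via-S′ v∉A v∉X (inS′ (inj₂ refl) s∈A) (u≼s v v∉A v∉X u~v)

        trace⊆ : trace W s ⊆ nbrOut G A S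
        trace⊆ {v} v∈trace with x∈p∪q⁻ (W ∩ ∁ A) _ v∈trace
        ... | inj₁ v∈W∖A with v∈W , v∈∁A ← x∈p∩q⁻ W (∁ A) v∈W∖A with W⁻ v∈W
        ...   | _ , inj₁ v∈S = contradiction (S⊆A v∈S) (x∈∁p⇒x∉p v∈∁A)
        ...   | _ , inj₂ v∈N = v∈N
        trace⊆ {v} v∈trace | inj₂ v∈N′∖X with nbrOut⁻ G A S′ (proj₁ (x∈p∩q⁻ _ (∁ X) v∈N′∖X))
        ... | v∉A , u , u∈S′ , u~v with x∈p∩q⁻ (W ∪ ⁅ s ⁆) A u∈S′
        ...   | u∈W∪s , u∈A with x∈p∪q⁻ W ⁅ s ⁆ u∈W∪s
        ...     | inj₂ u∈⁅s⁆ with refl ← to x∈⁅y⁆⇔x≡y u∈⁅s⁆ =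
                    let (u′ , u′∈S , u′~v) = sound u∈A v∉A u~v in nbrOut⁺ G A S v∉A u′∈S u′~v
        ...     | inj₁ u∈W with W⁻ u∈W
        ...       | _ , inj₁ u∈S = nbrOut⁺ G A S v∉A u∈S u~v
        ...       | _ , inj₂ u∈N = contradiction u∈A (proj₁ (nbrOut⁻ G A S u∈N))

  nbrOut∈traces : Nested → Fin n → ∀ {S} → S ⊆ A →
                  nbrOut G A S ∈ₗ cartesianProductWith trace (subsetsOf X) (allFin n)
  nbrOut∈traces nested z S⊆A with s , rep ← representative S⊆A nested z =
    subst (_∈ₗ _) (sym (nbrOut≡trace S⊆A rep))
      (cartesianProductWith⁺ trace (cong₂ trace) (∈-subsetsOf (proj₁ ∘ x∈p∩q⁻ X _)) (∈-allFin s))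

  boolCount≤ : Nested → Fin n → boolCount G A ≤ 2 ^ ∣ X ∣ * n
  boolCount≤ nested z = begin
    boolCount G A
      ≤⟨ Unique⇒length≤ (deduplicate-! (≡-dec _≟ᵇ_) _) (traced ∘ deduplicate⁻ (≡-dec _≟ᵇ_)) ⟩
    length (cartesianProductWith trace (subsetsOf X) (allFin n))
      ≡⟨ length-cartesianProductWith trace (subsetsOf X) (allFin n) ⟩
    length (subsetsOf X) * length (allFin n)
      ≡⟨ cong₂ _*_ (length-subsetsOf X) (length-tabulate id) ⟩
    2 ^ ∣ X ∣ * n ∎
    where
      open ≤-Reasoning
      traced : ∀ {N} → N ∈ₗ map (nbrOut G A) (filterᵇ (_⊆ᵇ A) (allSubsets n)) →
               N ∈ₗ cartesianProductWith trace (subsetsOf X) (allFin n)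
      traced N∈ with S , S∈ , refl ← ∈-map⁻ (nbrOut G A) N∈ =
        nbrOut∈traces nested z (⊆ᵇ⇒⊆ {S = S} (proj₂ (∈-filter⁻ (T? ∘ (_⊆ᵇ A)) {xs = allSubsets n} S∈)))

-- Cuts of interval graphs

data CutShape {n} (pos : Fin n → ℕ) (Side : Fin n → Set) : Set where
  singleton   : (∀ {a a'} → Side a → Side a' → a ≡ a') → CutShape pos Side
  cosingleton : (∀ {b b'} → ¬ Side b → ¬ Side b' → b ≡ b') → CutShape pos Side
  prefix      : (∀ {a b} → Side a → ¬ Side b → pos a < pos b) → CutShape pos Side
  suffix      : (∀ {a b} → Side a → ¬ Side b → pos b < pos a) → CutShape pos Side

CutShape-preimage : ∀ {k n} {pos : Fin k → ℕ} {P : Fin k → Set} {Q : Fin n → Set} {f : Fin n → Fin k} →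
                    Injective _≡_ _≡_ f → (∀ {v} → Q v ⇔ P (f v)) → CutShape pos P → CutShape (pos ∘ f) Q
CutShape-preimage f-injective Q⇔P (singleton unique)   =
  singleton λ Qa Qa' → f-injective (unique (to Q⇔P Qa) (to Q⇔P Qa'))
CutShape-preimage f-injective Q⇔P (cosingleton unique) =
  cosingleton λ ¬Qb ¬Qb' → f-injective (unique (¬Qb ∘ from Q⇔P) (¬Qb' ∘ from Q⇔P))
CutShape-preimage f-injective Q⇔P (prefix before)      = prefix λ Qa ¬Qb → before (to Q⇔P Qa) (¬Qb ∘ from Q⇔P)
CutShape-preimage f-injective Q⇔P (suffix after)       = suffix λ Qa ¬Qb → after (to Q⇔P Qa) (¬Qb ∘ from Q⇔P)

CutShape-complement : ∀ {n} {pos : Fin n → ℕ} {P Q : Fin n → Set} → Decidable P →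
                      (∀ {v} → Q v ⇔ (¬ P v)) → CutShape pos P → CutShape pos Q
CutShape-complement P? Q⇔¬P (singleton unique)   = cosingleton λ ¬Qb ¬Qb' →
  unique (decidable-stable (P? _) (¬Qb ∘ from Q⇔¬P)) (decidable-stable (P? _) (¬Qb' ∘ from Q⇔¬P))
CutShape-complement P? Q⇔¬P (cosingleton unique) = singleton λ Qa Qa' → unique (to Q⇔¬P Qa) (to Q⇔¬P Qa')
CutShape-complement P? Q⇔¬P (prefix before)      = suffix λ Qa ¬Qb →
  before (decidable-stable (P? _) (¬Qb ∘ from Q⇔¬P)) (to Q⇔¬P Qa)
CutShape-complement P? Q⇔¬P (suffix after)       = prefix λ Qa ¬Qb →
  after (decidable-stable (P? _) (¬Qb ∘ from Q⇔¬P)) (to Q⇔¬P Qa)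

module _ {n} (G : Graph n) (A X : Subset n) where
  open Traces G A X

  singleton-nested : (∀ {a a'} → a ∈ A → a' ∈ A → a ≡ a') → Nested
  singleton-nested unique a∈A _ a'∈A _ with refl ← unique a∈A a'∈A = inj₁ ≼-refl

  cosingleton-nested : (∀ {b b'} → b ∉ A → b' ∉ A → b ≡ b') → Nested
  cosingleton-nested unique {a} {a'} _ _ _ _
    with any? (λ b → ¬? (b ∈? A) ×-dec ¬? (b ∈? X) ×-dec T? (adj G a' b))
  ... | yes (b , b∉A , _ , a'~b) = inj₁ λ v v∉A _ _ → subst (T ∘ adj G a') (unique b∉A v∉A) a'~b
  ... | no ∄b = inj₂ λ v v∉A v∉X a'~v → contradiction (v , v∉A , v∉X , a'~v) ∄b

  module _ (l r : Fin n → ℕ) (l≤r : ∀ v → v ∉ X → l v ≤ r v)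
           (adj⇔overlap : ∀ u v → u ∉ X → v ∉ X → u ≢ v → (T (adj G u v) ⇔ (l u ≤ r v × l v ≤ r u)))
           (pos : Fin n → ℕ) (sorted : ∀ {a b} → a ∉ X → b ∉ X → pos a < pos b → l a ≤ l b) where

    private
      separated : ∀ {a v} → a ∈ A → v ∉ A → a ≢ v
      separated a∈A v∉A refl = v∉A a∈A

    prefix-dominance : (∀ {a b} → a ∈ A → b ∉ A → pos a < pos b) →
                       ∀ {a a'} → a ∈ A → a ∉ X → a' ∈ A → a' ∉ X → r a ≤ r a' → a ≼ a'
    prefix-dominance before {a} {a'} a∈A a∉X a'∈A a'∉X ra≤ra' v v∉A v∉X a~v =
      let (_ , lv≤ra) = to (adj⇔overlap a v a∉X v∉X (separated a∈A v∉A)) a~v in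
      from (adj⇔overlap a' v a'∉X v∉X (separated a'∈A v∉A))
        (≤-trans (sorted a'∉X v∉X (before a'∈A v∉A)) (l≤r v v∉X) , ≤-trans lv≤ra ra≤ra')

    suffix-dominance : (∀ {a b} → a ∈ A → b ∉ A → pos b < pos a) →
                       ∀ {a a'} → a ∈ A → a ∉ X → a' ∈ A → a' ∉ X → l a' ≤ l a → a ≼ a'
    suffix-dominance after {a} {a'} a∈A a∉X a'∈A a'∉X la'≤la v v∉A v∉X a~v =
      let (la≤rv , _) = to (adj⇔overlap a v a∉X v∉X (separated a∈A v∉A)) a~v in
      from (adj⇔overlap a' v a'∉X v∉X (separated a'∈A v∉A))
        (≤-trans la'≤la la≤rv , ≤-trans (sorted v∉X a'∉X (after a'∈A v∉A)) (l≤r a' a'∉X))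

    cut-nested : CutShape pos (_∈ A) → Nested
    cut-nested (singleton unique)   = singleton-nested unique
    cut-nested (cosingleton unique) = cosingleton-nested unique
    cut-nested (prefix before) {a} {a'} a∈A a∉X a'∈A a'∉X with ≤-total (r a) (r a')
    ... | inj₁ ra≤ra' = inj₁ (prefix-dominance before a∈A a∉X a'∈A a'∉X ra≤ra')
    ... | inj₂ ra'≤ra = inj₂ (prefix-dominance before a'∈A a'∉X a∈A a∉X ra'≤ra)
    cut-nested (suffix after) {a} {a'} a∈A a∉X a'∈A a'∉X with ≤-total (l a') (l a)
    ... | inj₁ la'≤la = inj₁ (suffix-dominance after a∈A a∉X a'∈A a'∉X la'≤la)
    ... | inj₂ la≤la' = inj₂ (suffix-dominance after a'∈A a'∉X a∈A a∉X la≤la')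

-- Sorting by left endpoints

injective⇒surjective : ∀ {n} {f : Fin n → Fin n} → Injective _≡_ _≡_ f → ∀ i → ∃ λ v → f v ≡ i
injective⇒surjective {suc n} {f} f-injective i with any? (λ v → f v Fin.≟ i)
... | yes found = found
... | no ∄v = contradiction (injective⇒≤ punchOut∘f-injective) 1+n≰n
  where
    i≢f : ∀ v → i ≢ f v
    i≢f v i≡fv = ∄v (v , sym i≡fv)
    punchOut∘f-injective : Injective _≡_ _≡_ (λ v → punchOut (i≢f v))
    punchOut∘f-injective eq = f-injective (punchOut-injective (i≢f _) (i≢f _) eq)

module Ranking {n} (key : Fin n → ℕ) (key-injective : Injective _≡_ _≡_ key) where

  below : Fin n → Subset n
  below v = tabulate λ u → key u <ᵇ key v

  ∈below⇔ : ∀ {u v} → u ∈ below v ⇔ key u < key v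
  ∈below⇔ {u} {v} = mk⇔ (<ᵇ⇒< _ _ ∘ subst T (lookup∘tabulate _ u) ∘ to ∈⇔T-lookup)
                        (from ∈⇔T-lookup ∘ subst T (sym (lookup∘tabulate _ u)) ∘ <⇒<ᵇ)

  rank : Fin n → ℕ
  rank v = ∣ below v ∣

  rank-<-mono : ∀ {u v} → key u < key v → rank u < rank v
  rank-<-mono u<v = p⊂q⇒∣p∣<∣q∣
    ( (λ w∈ → from ∈below⇔ (<-trans (to ∈below⇔ w∈) u<v))
    , _ , from ∈below⇔ u<v , <-irrefl refl ∘ to ∈below⇔ )

  rank<n : ∀ v → rank v < n
  rank<n v = subst (rank v <_) (∣⊤∣≡n n)
    (p⊂q⇒∣p∣<∣q∣ ((λ _ → ∈⊤) , v , ∈⊤ , <-irrefl refl ∘ to ∈below⇔))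

  rank-<-reflects : ∀ {u v} → rank u < rank v → key u < key v
  rank-<-reflects {u} {v} ru<rv with <-cmp (key u) (key v)
  ... | tri< u<v _ _ = u<v
  ... | tri≈ _ u≡v _ with refl ← key-injective u≡v = contradiction ru<rv (<-irrefl refl)
  ... | tri> _ _ v<u = contradiction ru<rv (<-asym (rank-<-mono v<u))

  rank-injective : Injective _≡_ _≡_ rank
  rank-injective {u} {v} ru≡rv with <-cmp (key u) (key v)
  ... | tri< u<v _ _ = contradiction ru≡rv (<⇒≢ (rank-<-mono u<v))
  ... | tri≈ _ u≡v _ = key-injective u≡v
  ... | tri> _ _ v<u = contradiction (sym ru≡rv) (<⇒≢ (rank-<-mono v<u))

  position : Fin n → Fin n
  position v = fromℕ< (rank<n v)

  toℕ-position : ∀ v → toℕ (position v) ≡ rank v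
  toℕ-position v = toℕ-fromℕ< (rank<n v)

  position-injective : Injective _≡_ _≡_ position
  position-injective {u} {v} eq =
    rank-injective (trans (sym (toℕ-position u)) (trans (cong toℕ eq) (toℕ-position v)))

  position-surjective : ∀ i → ∃ λ v → position v ≡ i
  position-surjective = injective⇒surjective position-injective

  position-<-reflects : ∀ {u v} → toℕ (position u) < toℕ (position v) → key u < key v
  position-<-reflects {u} {v} = rank-<-reflects ∘ subst₂ _<_ (toℕ-position u) (toℕ-position v)

module _ {n} (l : Fin n → ℕ) where

  lexKey : Fin n → ℕ
  lexKey v = l v * n + toℕ v

  lexKey-<-mono : ∀ {u v} → l u < l v → lexKey u < lexKey v
  lexKey-<-mono {u} {v} lu<lv = begin-strict
    l u * n + toℕ u <⟨ +-monoʳ-< (l u * n) (toℕ<n u) ⟩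
    l u * n + n     ≡⟨ +-comm (l u * n) n ⟩
    suc (l u) * n   ≤⟨ *-monoˡ-≤ n lu<lv ⟩
    l v * n         ≤⟨ m≤m+n (l v * n) (toℕ v) ⟩
    lexKey v        ∎
    where open ≤-Reasoning

  lexKey-injective : Injective _≡_ _≡_ lexKey
  lexKey-injective {u} {v} eq with <-cmp (l u) (l v)
  ... | tri< lu<lv _ _ = contradiction eq (<⇒≢ (lexKey-<-mono lu<lv))
  ... | tri> _ _ lv<lu = contradiction (sym eq) (<⇒≢ (lexKey-<-mono lv<lu))
  ... | tri≈ _ lu≡lv _ = toℕ-injective (+-cancelˡ-≡ (l u * n) (toℕ u) (toℕ v)
                            (trans eq (cong (λ x → x * n + toℕ v) (sym lu≡lv))))

  lexKey-<⇒≤ : ∀ {u v} → lexKey u < lexKey v → l u ≤ l v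
  lexKey-<⇒≤ {u} {v} lt = ≮⇒≥ λ lv<lu → <-asym lt (lexKey-<-mono lv<lu)

-- The caterpillar

module _ {m} {adj : Fin m → Fin m → Bool} where

  Walk-++ : ∀ {x y z} → Walk adj x y → Walk adj y z → Walk adj x z
  Walk-++ here          w' = w'
  Walk-++ (step xy w) w' = step xy (Walk-++ w w')

  Walk-reverse : (∀ u v → adj u v ≡ adj v u) → ∀ {x y} → Walk adj x y → Walk adj y x
  Walk-reverse adj-sym here                    = here
  Walk-reverse adj-sym (step {x} {y} xy w) =
    Walk-++ (Walk-reverse adj-sym w) (step (subst T (adj-sym x y) xy) here)

  WalkAvoid⇒Walk : ∀ {p q x y} → WalkAvoid adj p q x y → Walk adj x y
  WalkAvoid⇒Walk here               = here
  WalkAvoid⇒Walk (step xy _ _ w) = step xy (WalkAvoid⇒Walk w)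

countᵇ-tabulate : ∀ {m} {A : Set} (p : A → Bool) (g : Fin m → A) →
                  Vec.countᵇ p (Vec.tabulate g) ≡ length (filterᵇ p (List.tabulate g))
countᵇ-tabulate {zero}  p g = refl
countᵇ-tabulate {suc m} p g with p (g Fin.zero)
... | true  = cong suc (countᵇ-tabulate p (g ∘ Fin.suc))
... | false = countᵇ-tabulate p (g ∘ Fin.suc)

degree≡length : ∀ {m} (adj : Fin m → Fin m → Bool) {v} {ns : List (Fin m)} → Unique ns →
                (∀ {u} → T (adj v u) ⇔ u ∈ₗ ns) → degree adj v ≡ length ns
degree≡length {m} adj {v} {ns} ns! ∈ns⇔ = trans (countᵇ-tabulate (adj v) id)
  (≤-antisym (Unique⇒length≤ (Unique.filter⁺ (T? ∘ adj v) (Unique.allFin⁺ m))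
                             (to ∈ns⇔ ∘ proj₂ ∘ ∈-filter⁻ (T? ∘ adj v) {xs = List.allFin m}))
             (Unique⇒length≤ ns! λ {u} u∈ns → ∈-filter⁺ (T? ∘ adj v) (∈-allFin u) (from ∈ns⇔ u∈ns)))

module Caterpillar (M : ℕ) where

  leaves spines : ℕ
  leaves = 3 + M
  spines = 1 + M

  data Node : Set where
    leaf  : (i : ℕ) → .(i < leaves) → Node
    spine : (c : ℕ) → .(c < spines) → Node

  leaf-cong : ∀ {i j} .{p q} → i ≡ j → leaf i p ≡ leaf j q
  leaf-cong refl = refl

  spine-cong : ∀ {c d} .{p q} → c ≡ d → spine c p ≡ spine d q
  spine-cong refl = refl

  -- The spine ends carry two leaves each, every inner spine node one.
  hang : ℕ → ℕ
  hang i = (i ∸ 1) ⊓ M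

  hang<spines : ∀ i → hang i < spines
  hang<spines i = s≤s (m⊓n≤n (i ∸ 1) M)

  hang-mono : ∀ {i j} → i ≤ j → hang i ≤ hang j
  hang-mono i≤j = ⊓-monoˡ-≤ M (∸-monoˡ-≤ 1 i≤j)

  data Link : Node → Node → Set where
    hangs : ∀ i .(p : i < leaves) → Link (leaf i p) (spine (hang i) (hang<spines i))
    next  : ∀ c .(p : c < spines) .(q : suc c < spines) → Link (spine c p) (spine (suc c) q)

  infix 4 _~_
  _~_ : Node → Node → Set
  x ~ y = Link x y ⊎ Link y x

  ~-sym : ∀ {x y} → x ~ y → y ~ x
  ~-sym = Sum.swap

  link? : ∀ x y → Dec (Link x y)
  link? (leaf i p) (spine c q) with c ≟ hang i
  ... | yes refl = yes (hangs i p)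
  ... | no c≢hang = no λ { (hangs _ _) → c≢hang refl }
  link? (spine c p) (spine d q) with suc c ≟ d
  ... | yes refl = yes (next c p q)
  ... | no sc≢d = no λ { (next _ _ _) → sc≢d refl }
  link? (leaf _ _)  (leaf _ _)  = no λ ()
  link? (spine _ _) (leaf _ _)  = no λ ()

  link-irreflexive : ∀ {x} → ¬ Link x x
  link-irreflexive ()

  Avoids : Node → Node → Node → Node → Set
  Avoids a b x y = ¬ (x ≡ a × y ≡ b) × ¬ (x ≡ b × y ≡ a)

  Avoids-sym : ∀ {a b x y} → Avoids a b x y → Avoids a b y x
  Avoids-sym (¬ab , ¬ba) = ¬ba ∘ swap , ¬ab ∘ swap

  Avoids-flip : ∀ {a b x y} → Avoids a b x y → Avoids b a x y
  Avoids-flip = swap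

  data Path (a b : Node) : Node → Node → Set where
    []   : ∀ {x} → Path a b x x
    step : ∀ {x y z} → x ~ y → Avoids a b x y → Path a b y z → Path a b x z

  infixr 5 _++ₚ_
  _++ₚ_ : ∀ {a b x y z} → Path a b x y → Path a b y z → Path a b x z
  []               ++ₚ ys = ys
  step x~y av xs   ++ₚ ys = step x~y av (xs ++ₚ ys)

  reverse : ∀ {a b x y} → Path a b x y → Path a b y x
  reverse []                = []
  reverse (step x~y av xs) = reverse xs ++ₚ step (~-sym x~y) (Avoids-sym av) []

  flip : ∀ {a b x y} → Path a b x y → Path b a x y
  flip []                = []
  flip (step x~y av xs) = step x~y (Avoids-flip av) (flip xs)

  SafeSpineStep : Node → Node → ℕ → Set
  SafeSpineStep a b e =
    ∀ .(p : e < spines) .(q : suc e < spines) → Avoids a b (spine e p) (spine (suc e) q)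

  ascend : ∀ {a b c d} .(p : c < spines) .(q : d < spines) → c ≤′ d →
           (∀ {e} → c ≤ e → e < d → SafeSpineStep a b e) → Path a b (spine c p) (spine d q)
  ascend p q (≤′-reflexive refl) safe = []
  ascend {d = suc d} p q (≤′-step c≤′d) safe =
    ascend p (<-trans (n<1+n d) q) c≤′d (λ c≤e e<d → safe c≤e (<-trans e<d (n<1+n d)))
      ++ₚ step (inj₁ (next d _ q)) (safe (≤′⇒≤ c≤′d) (n<1+n d) _ q) []

  spine-path : ∀ {a b c d} .(p : c < spines) .(q : d < spines) → (∀ {e} → SafeSpineStep a b e) →
               Path a b (spine c p) (spine d q)
  spine-path {c = c} {d} p q safe with ≤-total c d
  ... | inj₁ c≤d = ascend p q (≤⇒≤′ c≤d) λ _ _ → safe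
  ... | inj₂ d≤c = reverse (ascend q p (≤⇒≤′ d≤c) λ _ _ → safe)

  leafAt : Fin leaves → Node
  leafAt i = leaf (toℕ i) (toℕ<n i)

  -- A colouring that changes only across the edge {a , b} and whose two classes are connected
  -- without it: it shows that the edge is a bridge and describes the cut it induces.
  record Separation (a b : Node) : Set where
    field
      side      : Node → Bool
      side-a    : T (side a)
      side-b    : ¬ T (side b)
      preserved : ∀ {x y} → x ~ y → Avoids a b x y → side x ≡ side y
      to-a      : ∀ {x} → T (side x) → Path a b x a
      to-b      : ∀ {x} → ¬ T (side x) → Path a b x b
      shape     : CutShape toℕ (T ∘ side ∘ leafAt)

  flip-separation : ∀ {a b} → Separation a b → Separation b a
  flip-separation sep = record
    { side      = not ∘ side
    ; side-a    = from T-not side-b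
    ; side-b    = λ ¬side-a → to T-not ¬side-a side-a
    ; preserved = λ x~y av → cong not (preserved x~y (Avoids-flip av))
    ; to-a      = flip ∘ to-b ∘ to T-not
    ; to-b      = λ ¬side → flip (to-a (decidable-stable (T? _) (¬side ∘ from T-not)))
    ; shape     = CutShape-complement (T? ∘ side ∘ leafAt) T-not shape
    }
    where open Separation sep

  isLeaf : ℕ → Node → Bool
  isLeaf i (leaf j _)  = ⌊ j ≟ i ⌋
  isLeaf i (spine _ _) = false

  leaf-separation : ∀ i .(p : i < leaves) → Separation (leaf i p) (spine (hang i) (hang<spines i))
  leaf-separation i p = record
    { side      = isLeaf i
    ; side-a    = fromWitness refl
    ; side-b    = λ ()
    ; preserved = preserved
    ; to-a      = to-a
    ; to-b      = to-b
    ; shape     = singleton λ k≡i k'≡i → toℕ-injective (trans (toWitness k≡i) (sym (toWitness k'≡i)))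
    }
    where
      a b : Node
      a = leaf i p
      b = spine (hang i) (hang<spines i)

      preserved : ∀ {x y} → x ~ y → Avoids a b x y → isLeaf i x ≡ isLeaf i y
      preserved (inj₁ (hangs j _)) (¬ab , _) with j ≟ i
      ... | yes refl = contradiction (refl , refl) ¬ab
      ... | no _     = refl
      preserved (inj₂ (hangs j _)) (_ , ¬ba) with j ≟ i
      ... | yes refl = contradiction (refl , refl) ¬ba
      ... | no _     = refl
      preserved (inj₁ (next _ _ _)) _ = refl
      preserved (inj₂ (next _ _ _)) _ = refl

      spine-safe : ∀ {e} → SafeSpineStep a b e
      spine-safe _ _ = (λ { (() , _) }) , (λ { (_ , ()) })

      to-a : ∀ {x} → T (isLeaf i x) → Path a b x a
      to-a {leaf j _} j≡i with refl ← toWitness j≡i = []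

      to-b : ∀ {x} → ¬ T (isLeaf i x) → Path a b x b
      to-b {leaf j q}  j≢i =
        step (inj₁ (hangs j q)) ((λ { (refl , _) → j≢i (fromWitness refl) }) , (λ { (() , _) }))
             (spine-path _ _ spine-safe)
      to-b {spine _ q} _   = spine-path q _ spine-safe

  spot : Node → ℕ
  spot (leaf i _)  = hang i
  spot (spine c _) = c

  ≤?-step : ∀ {e c} → e ≢ c → ⌊ e ≤? c ⌋ ≡ ⌊ suc e ≤? c ⌋
  ≤?-step {e} {c} e≢c with e ≤? c | suc e ≤? c
  ... | yes _   | yes _    = refl
  ... | no _    | no _     = refl
  ... | yes e≤c | no se≰c  = contradiction (≤∧≢⇒< e≤c e≢c) se≰c
  ... | no e≰c  | yes se≤c = contradiction (<⇒≤ se≤c) e≰c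

  spine-separation : ∀ c .(p : c < spines) .(q : suc c < spines) →
                     Separation (spine c p) (spine (suc c) q)
  spine-separation c p q = record
    { side      = λ x → ⌊ spot x ≤? c ⌋
    ; side-a    = fromWitness ≤-refl
    ; side-b    = 1+n≰n ∘ toWitness
    ; preserved = preserved
    ; to-a      = to-a
    ; to-b      = to-b
    ; shape     = prefix λ {i} {j} i≤ j≰ → ≰⇒> λ j≤i →
                    j≰ (fromWitness (≤-trans (hang-mono j≤i) (toWitness i≤)))
    }
    where
      a b : Node
      a = spine c p
      b = spine (suc c) q

      preserved : ∀ {x y} → x ~ y → Avoids a b x y → ⌊ spot x ≤? c ⌋ ≡ ⌊ spot y ≤? c ⌋
      preserved (inj₁ (hangs _ _)) _ = refl
      preserved (inj₂ (hangs _ _)) _ = refl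
      preserved (inj₁ (next e _ _)) (¬ab , _) with e ≟ c
      ... | yes refl = contradiction (refl , refl) ¬ab
      ... | no e≢c   = ≤?-step e≢c
      preserved (inj₂ (next e _ _)) (_ , ¬ba) with e ≟ c
      ... | yes refl = contradiction (refl , refl) ¬ba
      ... | no e≢c   = sym (≤?-step e≢c)

      hang-step : ∀ {j} .(r : j < leaves) → Avoids a b (leaf j r) (spine (hang j) (hang<spines j))
      hang-step _ = (λ { (() , _) }) , (λ { (() , _) })

      below-safe : ∀ {e} → e < c → SafeSpineStep a b e
      below-safe e<c _ _ =
        (λ { (refl , _) → <-irrefl refl e<c }) , (λ { (refl , _) → <-asym e<c (n<1+n c) })

      above-safe : ∀ {e} → suc c ≤ e → SafeSpineStep a b e
      above-safe c<e _ _ =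
        (λ { (refl , _) → <-irrefl refl c<e }) , (λ { (_ , refl) → <-irrefl refl (<-trans (n<1+n _) c<e) })

      to-a : ∀ {x} → T ⌊ spot x ≤? c ⌋ → Path a b x a
      to-a {leaf j r}  j≤c = step (inj₁ (hangs j r)) (hang-step r)
                               (ascend _ p (≤⇒≤′ (toWitness j≤c)) λ _ e<c → below-safe e<c)
      to-a {spine d r} d≤c = ascend r p (≤⇒≤′ (toWitness d≤c)) λ _ e<c → below-safe e<c

      to-b : ∀ {x} → ¬ T ⌊ spot x ≤? c ⌋ → Path a b x b
      to-b {leaf j r}  j≰c = step (inj₁ (hangs j r)) (hang-step r)
                               (reverse (ascend q _ (≤⇒≤′ (≰⇒> (j≰c ∘ fromWitness))) λ c<e _ →
                                  above-safe c<e))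
      to-b {spine d r} d≰c = reverse (ascend q r (≤⇒≤′ (≰⇒> (d≰c ∘ fromWitness))) λ c<e _ → above-safe c<e)

  separation : ∀ {a b} → a ~ b → Separation a b
  separation (inj₁ (hangs i p))   = leaf-separation i p
  separation (inj₁ (next c p q))  = spine-separation c p q
  separation (inj₂ (hangs i p))   = flip-separation (leaf-separation i p)
  separation (inj₂ (next c p q))  = flip-separation (spine-separation c p q)

  nodes : ℕ
  nodes = leaves + spines

  spineAt : Fin spines → Node
  spineAt c = spine (toℕ c) (toℕ<n c)

  encode : Node → Fin nodes
  encode (leaf i p)  = Fin.join leaves spines (inj₁ (fromℕ< p))
  encode (spine c p) = Fin.join leaves spines (inj₂ (fromℕ< p))

  decode : Fin nodes → Node
  decode = Sum.[ leafAt , spineAt ] ∘ Fin.splitAt leaves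

  decode-encode : ∀ x → decode (encode x) ≡ x
  decode-encode (leaf i p)  rewrite splitAt-join leaves spines (inj₁ (fromℕ< p)) = leaf-cong (toℕ-fromℕ< p)
  decode-encode (spine c p) rewrite splitAt-join leaves spines (inj₂ (fromℕ< p)) = spine-cong (toℕ-fromℕ< p)

  encode-canonical : ∀ k → encode (Sum.[ leafAt , spineAt ] k) ≡ Fin.join leaves spines k
  encode-canonical (inj₁ i) = cong (Fin.join leaves spines ∘ inj₁) (fromℕ<-toℕ i _)
  encode-canonical (inj₂ c) = cong (Fin.join leaves spines ∘ inj₂) (fromℕ<-toℕ c _)

  encode-decode : ∀ s → encode (decode s) ≡ s
  encode-decode s = trans (encode-canonical (Fin.splitAt leaves s)) (join-splitAt leaves spines s)

  encode-injective : ∀ {x y} → encode x ≡ encode y → x ≡ y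
  encode-injective {x} {y} eq = trans (sym (decode-encode x)) (trans (cong decode eq) (decode-encode y))

  decode-injective : ∀ {s t} → decode s ≡ decode t → s ≡ t
  decode-injective {s} {t} eq = trans (sym (encode-decode s)) (trans (cong encode eq) (encode-decode t))

  adjacent : Fin nodes → Fin nodes → Bool
  adjacent s t = ⌊ link? (decode s) (decode t) ⌋ ∨ ⌊ link? (decode t) (decode s) ⌋

  adjacent⇔ : ∀ {s t} → T (adjacent s t) ⇔ decode s ~ decode t
  adjacent⇔ {s} {t} = mk⇔ linked adjacent-of
    where
      x y : Node
      x = decode s
      y = decode t
      linked : T (⌊ link? x y ⌋ ∨ ⌊ link? y x ⌋) → x ~ y
      linked = Sum.map toWitness toWitness ∘ to (T-∨ {⌊ link? x y ⌋})
      adjacent-of : x ~ y → T (⌊ link? x y ⌋ ∨ ⌊ link? y x ⌋)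
      adjacent-of = from (T-∨ {⌊ link? x y ⌋}) ∘ Sum.map fromWitness fromWitness

  adjacent-encode : ∀ {x y} → x ~ y → T (adjacent (encode x) (encode y))
  adjacent-encode {x} {y} =
    from (adjacent⇔ {encode x} {encode y}) ∘ subst₂ _~_ (sym (decode-encode x)) (sym (decode-encode y))

  adjacent-sym : ∀ s t → adjacent s t ≡ adjacent t s
  adjacent-sym s t = ∨-comm ⌊ link? (decode s) (decode t) ⌋ _

  adjacent-irreflexive : ∀ s → adjacent s s ≡ false
  adjacent-irreflexive s with link? (decode s) (decode s)
  ... | yes loop = contradiction loop link-irreflexive
  ... | no _     = refl

  Path⇒WalkAvoid : ∀ {a b x y} → Path a b x y →
                   WalkAvoid adjacent (encode a) (encode b) (encode x) (encode y)
  Path⇒WalkAvoid []                        = here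
  Path⇒WalkAvoid (step x~y (¬ab , ¬ba) w) =
    step (adjacent-encode x~y) (¬ab ∘ Prod.map encode-injective encode-injective)
         (¬ba ∘ Prod.map encode-injective encode-injective) (Path⇒WalkAvoid w)

  side-preserved : ∀ {p q} (sep : Separation (decode p) (decode q)) → ∀ {s t} → WalkAvoid adjacent p q s t →
                   Separation.side sep (decode s) ≡ Separation.side sep (decode t)
  side-preserved sep here = refl
  side-preserved sep (step {s} {t} st ¬pq ¬qp w) =
    trans (Separation.preserved sep (to (adjacent⇔ {s} {t}) st) (decode-avoids ¬pq , decode-avoids ¬qp))
          (side-preserved sep w)
    where
      decode-avoids : ∀ {p q} → ¬ (s ≡ p × t ≡ q) → ¬ (decode s ≡ decode p × decode t ≡ decode q)
      decode-avoids ¬pq = ¬pq ∘ Prod.map decode-injective decode-injective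

  hub : Node
  hub = leaf 0 (s≤s z≤n)

  -- Connectivity, too, comes from the separation of one edge.
  to-hub : ∀ x → Walk adjacent (encode x) (encode hub)
  to-hub x = via (T? (side x))
    where
      open Separation (leaf-separation 0 (s≤s z≤n))
      via : Dec (T (side x)) → Walk adjacent (encode x) (encode hub)
      via (yes hub-side) = WalkAvoid⇒Walk (Path⇒WalkAvoid (to-a {x} hub-side))
      via (no other-side) = Walk-++ (WalkAvoid⇒Walk (Path⇒WalkAvoid (to-b {x} other-side)))
                                    (step (adjacent-encode (inj₂ (hangs 0 (s≤s z≤n)))) here)

  edge-is-bridge : ∀ p q → T (adjacent p q) → ¬ WalkAvoid adjacent p q p q
  edge-is-bridge p q pq w = side-b (subst T (side-preserved sep w) side-a)
    where
      sep : Separation (decode p) (decode q)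
      sep = separation (to (adjacent⇔ {p} {q}) pq)
      open Separation sep

  caterpillar : Tree nodes
  caterpillar = record
    { tadj      = adjacent
    ; tsym      = adjacent-sym
    ; tirrefl   = adjacent-irreflexive
    ; connected = λ s t → subst₂ (Walk adjacent) (encode-decode s) (encode-decode t)
                            (Walk-++ (to-hub (decode s)) (Walk-reverse adjacent-sym (to-hub (decode t))))
    ; acyclic   = edge-is-bridge
    }

  lower : ∀ c → .(c < spines) → Node
  lower zero    _ = leaf 0 (s≤s z≤n)
  lower (suc c) p = spine c (<-trans (n<1+n c) p)

  upper : ∀ c → .(c < spines) → Node
  upper c p with c ≟ M
  ... | yes _   = leaf (suc (suc c)) (s≤s (s≤s p))
  ... | no c≢M = spine (suc c) (s≤s (≤∧≢⇒< (≤-pred p) c≢M))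

  neighbours : Node → List Node
  neighbours (leaf i p)  = spine (hang i) (hang<spines i) ∷ []
  neighbours (spine c p) = lower c p ∷ leaf (suc c) (s≤s (m<n⇒m<1+n p)) ∷ upper c p ∷ []

  spine≤M : ∀ {c} → .(c < spines) → c ≤ M
  spine≤M {c} p = ≤-pred (recompute (c <? spines) p)

  leaf≤M+2 : ∀ {i} → .(i < leaves) → i ≤ 2 + M
  leaf≤M+2 {i} p = ≤-pred (recompute (i <? leaves) p)

  hangs′ : ∀ {i c} .{p q} → hang i ≡ c → Link (leaf i p) (spine c q)
  hangs′ refl = hangs _ _

  neighbour-linked : ∀ {x y} → y ∈ₗ neighbours x → x ~ y
  neighbour-linked {leaf i p}        (here refl)                 = inj₁ (hangs i p)
  neighbour-linked {spine zero p}    (here refl)                 = inj₂ (hangs 0 (s≤s z≤n))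
  neighbour-linked {spine (suc c) p} (here refl)                 = inj₂ (next c _ p)
  neighbour-linked {spine c p}       (there (here refl))         = inj₂ (hangs′ (m≤n⇒m⊓n≡m (spine≤M p)))
  neighbour-linked {spine c p}       (there (there (here refl))) with c ≟ M
  ... | yes refl = inj₂ (hangs′ (m≥n⇒m⊓n≡n (n≤1+n M)))
  ... | no _     = inj₁ (next c p _)

  linked-neighbour : ∀ {x y} → x ~ y → y ∈ₗ neighbours x
  linked-neighbour (inj₁ (hangs i p))  = here refl
  linked-neighbour (inj₁ (next c p q)) with c ≟ M
  ... | yes refl = contradiction (spine≤M q) 1+n≰n
  ... | no _     = there (there (here refl))
  linked-neighbour (inj₂ (next c p q)) = here refl
  linked-neighbour (inj₂ (hangs i p))  = hang-neighbour refl
    where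
      hang-neighbour : ∀ {c i} .{p q} → c ≡ hang i → leaf i q ∈ₗ neighbours (spine c p)
      hang-neighbour {i = zero}  refl = here refl
      hang-neighbour {c} {suc j} {q = q} c≡hang with j ≤? M
      ... | yes j≤M with refl ← trans c≡hang (m≤n⇒m⊓n≡m j≤M) = there (here refl)
      ... | no j≰M with c ≟ M
      ...   | yes refl =
              there (there (here (leaf-cong (cong suc (≤-antisym (≤-pred (leaf≤M+2 q)) (≰⇒> j≰M))))))
      ...   | no c≢M = contradiction (trans c≡hang (m≥n⇒m⊓n≡n (<⇒≤ (≰⇒> j≰M)))) c≢M

  neighbours-unique : ∀ x → Unique (neighbours x)
  neighbours-unique (leaf _ _)  = [] ∷ []
  neighbours-unique (spine c p) = (lower≢middle c ∷ lower≢upper c ∷ []) ∷ (middle≢upper c ∷ []) ∷ [] ∷ []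
    where
      lower≢middle : ∀ c .{p q} → lower c p ≢ leaf (suc c) q
      lower≢middle zero    ()
      lower≢middle (suc c) ()

      lower≢upper : ∀ c .{p} → lower c p ≢ upper c p
      lower≢upper c with c ≟ M
      lower≢upper zero    | yes _ = λ ()
      lower≢upper zero    | no _  = λ ()
      lower≢upper (suc c) | yes _ = λ ()
      lower≢upper (suc c) | no _  = λ ()

      middle≢upper : ∀ c .{p q} → leaf (suc c) q ≢ upper c p
      middle≢upper c with c ≟ M
      ... | yes _ = λ ()
      ... | no _  = λ ()

  degree-decode : ∀ t → degree adjacent t ≡ length (neighbours (decode t))
  degree-decode t = begin
    degree adjacent t
      ≡⟨ degree≡length adjacent {t} unique (mk⇔ adjacent⇒∈ ∈⇒adjacent) ⟩
    length (List.map encode (neighbours (decode t)))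
      ≡⟨ length-map encode (neighbours (decode t)) ⟩
    length (neighbours (decode t))                   ∎
    where
      open ≡-Reasoning
      unique : Unique (List.map encode (neighbours (decode t)))
      unique = Unique.map⁺ (λ {x} {y} → encode-injective {x} {y}) (neighbours-unique (decode t))

      adjacent⇒∈ : ∀ {u} → T (adjacent t u) → u ∈ₗ List.map encode (neighbours (decode t))
      adjacent⇒∈ {u} tu =
        subst (_∈ₗ _) (encode-decode u) (∈-map⁺ encode (linked-neighbour (to (adjacent⇔ {t} {u}) tu)))

      ∈⇒adjacent : ∀ {u} → u ∈ₗ List.map encode (neighbours (decode t)) → T (adjacent t u)
      ∈⇒adjacent u∈ with y , y∈ , refl ← ∈-map⁻ encode u∈ =
        from (adjacent⇔ {t} {encode y}) (subst (decode t ~_) (sym (decode-encode y)) (neighbour-linked y∈))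

  degree-1-or-3 : ∀ t → degree adjacent t ≡ 1 ⊎ degree adjacent t ≡ 3
  degree-1-or-3 t with decode t | degree-decode t
  ... | leaf _ _  | d = inj₁ d
  ... | spine _ _ | d = inj₂ d

  degree-leafAt : ∀ i → degree adjacent (encode (leafAt i)) ≡ 1
  degree-leafAt i =
    trans (degree-decode (encode (leafAt i))) (cong (length ∘ neighbours) (decode-encode (leafAt i)))

  leaf-injective : ∀ {i j} .{p q} → leaf i p ≡ leaf j q → i ≡ j
  leaf-injective refl = refl

  leafAt-injective : ∀ {i j} → leafAt i ≡ leafAt j → i ≡ j
  leafAt-injective = toℕ-injective ∘ leaf-injective

  module _ {position : Fin leaves → Fin leaves} (position-injective : Injective _≡_ _≡_ position)
           (position-surjective : ∀ i → ∃ λ v → position v ≡ i) where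

    leaf-of-degree-1 : ∀ t → degree adjacent t ≡ 1 → ∃ λ v → encode (leafAt (position v)) ≡ t
    leaf-of-degree-1 t d with decode t in dt | degree-decode t
    ... | leaf i p | _ with v , pv≡i ← position-surjective (fromℕ< p) =
          v , (begin
            encode (leafAt (position v)) ≡⟨ cong (encode ∘ leafAt) pv≡i ⟩
            encode (leafAt (fromℕ< p))   ≡⟨ cong encode (leaf-cong (toℕ-fromℕ< p)) ⟩
            encode (leaf i p)            ≡⟨ cong encode (sym dt) ⟩
            encode (decode t)            ≡⟨ encode-decode t ⟩
            t                            ∎)
      where open ≡-Reasoning
    ... | spine _ _ | d′ = contradiction (trans (sym d′) d) λ ()

    decomposition : DecompTree leaves nodes
    decomposition = record
      { tree      = caterpillar
      ; deg13     = degree-1-or-3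
      ; leaf      = encode ∘ leafAt ∘ position
      ; leaf-leaf = degree-leafAt ∘ position
      ; leaf-inj  = position-injective ∘ leafAt-injective ∘ encode-injective
      ; leaf-onto = leaf-of-degree-1
      }

    cut-shape : ∀ {p q} → T (adjacent p q) → ∀ {A} → IsCut decomposition p q A →
                CutShape (toℕ ∘ position) (_∈ A)
    cut-shape {p} {q} pq {A} cut = CutShape-preimage position-injective ∈A⇔ shape
      where
        sep : Separation (decode p) (decode q)
        sep = separation (to (adjacent⇔ {p} {q}) pq)
        open Separation sep

        walk⇒side : ∀ {x} → WalkAvoid adjacent p q (encode x) p → T (side x)
        walk⇒side {x} w = subst T (trans (sym (side-preserved sep w)) (cong side (decode-encode x))) side-a

        side⇒walk : ∀ {x} → T (side x) → WalkAvoid adjacent p q (encode x) p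
        side⇒walk {x} =
          subst₂ (λ p′ q′ → WalkAvoid adjacent p′ q′ (encode x) p′) (encode-decode p) (encode-decode q)
          ∘ Path⇒WalkAvoid ∘ to-a

        ∈A⇔ : ∀ {v} → v ∈ A ⇔ T (side (leafAt (position v)))
        ∈A⇔ {v} = mk⇔ (walk⇒side ∘ to (cut v) ∘ to ∈⇔T-lookup) (from ∈⇔T-lookup ∘ from (cut v) ∘ side⇒walk)

single-edge : Tree 2
single-edge = record
  { tadj      = distinct
  ; tsym      = λ { fzero fzero → refl ; fzero (fsuc fzero) → refl
                  ; (fsuc fzero) fzero → refl ; (fsuc fzero) (fsuc fzero) → refl }
  ; tirrefl   = λ { fzero → refl ; (fsuc fzero) → refl }
  ; connected = λ { fzero fzero → here ; fzero (fsuc fzero) → step _ here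
                  ; (fsuc fzero) fzero → step _ here ; (fsuc fzero) (fsuc fzero) → here }
  ; acyclic   = no-cycle
  }
  where
    distinct : Fin 2 → Fin 2 → Bool
    distinct u v = not ⌊ u Fin.≟ v ⌋
    no-cycle : ∀ p q → T (distinct p q) → ¬ WalkAvoid distinct p q p q
    no-cycle fzero        (fsuc fzero) _ (step {y = fzero} () _ _ _)
    no-cycle fzero        (fsuc fzero) _ (step {y = fsuc fzero} _ ¬pq _ _) = ¬pq (refl , refl)
    no-cycle (fsuc fzero) fzero        _ (step {y = fzero} _ ¬pq _ _) = ¬pq (refl , refl)
    no-cycle (fsuc fzero) fzero        _ (step {y = fsuc fzero} () _ _ _)
    no-cycle fzero        fzero        ()
    no-cycle (fsuc fzero) (fsuc fzero) ()

single-edge-decomposition : DecompTree 2 2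
single-edge-decomposition = record
  { tree      = single-edge
  ; deg13     = λ { fzero → inj₁ refl ; (fsuc fzero) → inj₁ refl }
  ; leaf      = λ v → v
  ; leaf-leaf = λ { fzero → refl ; (fsuc fzero) → refl }
  ; leaf-inj  = λ eq → eq
  ; leaf-onto = λ t _ → t , refl
  }

two-vertex-nested : (G : Graph 2) (A X : Subset 2) → Traces.Nested G A X
two-vertex-nested G (inside ∷ inside ∷ []) X =
  cosingleton-nested G _ X λ {b} b∉A → contradiction (full b) b∉A
  where
    full : ∀ b → b ∈ inside ∷ inside ∷ []
    full fzero        = Vec.here
    full (fsuc fzero) = Vec.there Vec.here
two-vertex-nested G (outside ∷ s ∷ []) X =
  singleton-nested G _ X λ a∈A a'∈A → trans (second a∈A) (sym (second a'∈A))
  where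
    second : ∀ {a} → a ∈ outside ∷ s ∷ [] → a ≡ fsuc fzero
    second (Vec.there Vec.here) = refl
two-vertex-nested G (inside ∷ outside ∷ []) X =
  singleton-nested G _ X λ a∈A a'∈A → trans (first a∈A) (sym (first a'∈A))
  where
    first : ∀ {a} → a ∈ inside ∷ outside ∷ [] → a ≡ fzero
    first Vec.here       = refl
    first (Vec.there (Vec.there ()))

boolCount≤n*2^k : ∀ {n} (G : Graph n) {A X : Subset n} {k} → ∣ X ∣ ≤ k → Fin n →
                  Traces.Nested G A X → boolCount G A ≤ n * 2 ^ k
boolCount≤n*2^k {n} G {A} {X} {k} |X|≤k z nested = begin
  boolCount G A  ≤⟨ Traces.boolCount≤ G A X nested z ⟩
  2 ^ ∣ X ∣ * n  ≤⟨ *-monoˡ-≤ n (^-monoʳ-≤ 2 |X|≤k) ⟩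
  2 ^ k * n      ≡⟨ *-comm (2 ^ k) n ⟩
  n * 2 ^ k      ∎
  where open ≤-Reasoning

lemma3 : ∀ {n : ℕ} (G : Graph n) (k : ℕ) (X : Subset n) →
         1 ≤ n → ∣ X ∣ ≤ k → IsIntervalAfterDeleting G X →
         BoolWidth≤log G (n * 2 ^ k)
lemma3 {0} G k X () _ _
lemma3 {1} G k X _ _ _ = inj₁ (≤-refl , subst (1 ≤_) (sym (*-identityˡ (2 ^ k))) (m^n>0 2 k))
lemma3 {2} G k X _ |X|≤k _ =
  inj₂ (≤-refl , 2 , single-edge-decomposition , λ _ _ _ A _ →
        boolCount≤n*2^k G |X|≤k fzero (two-vertex-nested G A X))
lemma3 {suc (suc (suc M))} G k X _ |X|≤k (l , r , l≤r , adj⇔overlap) =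
  inj₂ (s≤s (s≤s z≤n) , nodes , decomposition position-injective position-surjective , λ p q pq A cut →
        boolCount≤n*2^k G |X|≤k fzero
          (cut-nested G A X l r l≤r adj⇔overlap (toℕ ∘ position) sorted
             (cut-shape position-injective position-surjective pq cut)))
  where
    open Caterpillar M
    open Ranking (lexKey l) (lexKey-injective l)
    sorted : ∀ {a b} → a ∉ X → b ∉ X → toℕ (position a) < toℕ (position b) → l a ≤ l b
    sorted _ _ = lexKey-<⇒≤ l ∘ position-<-reflects
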